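{- Let $G=(V,E,O,Pr)$ be a parity game, $J=(V,D,H)$ a weakly winning justification for $G$, $v\in V$ a node and $dj$ a direct justification of $v$ (for some player). Then: (i) If $H(v)=\bar\alpha$, $v$ has no incoming edges in $D$, and $dj$ wins $v$ for $\alpha$ under $H$, then $J'=J[v:dj,\alpha]$ is weakly winning and there are no cycles in $J'$ containing edges of $dj$. (ii) Let $S\subseteq V$ be closed under incoming edges (if $u\in S$ and $(w,u)\in D$ then $w\in S$) and let $H_f:S\to\{0,1\}$ be arbitrary. Then $J'=J[u:\emptyset,H_f(u)\mid u\in S]$ is weakly winning, and every cycle of $J'$ is a cycle of $J$. (iii) If $H(v)=\alpha$ and $dj$ wins $v$ for $\alpha$ under $H$, then $J'=J[v:dj,\alpha]$ is weakly winning. Moreover, if $(v,v)\notin dj$ and no node $w$ with $(v,w)\in dj$ can reach $v$ in $(V,D)$, then $J'$ has no cycles that are not cycles of $J$; otherwise every cycle of $J'$ that is not a cycle of $J$ passes through $v$ and contains at least one edge of $dj$.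
   Context: A parity game is a tuple $G=(V,E,O,Pr)$ with nodes $V$, moves $E\subseteq V\times V$ (every node has an outgoing edge), owner function $O:V\to\{0,1\}$ and priority function $Pr:V\to\mathbb{N}$. For a player $\alpha\in\{0,1\}$, $\bar\alpha=1-\alpha$. A direct justification for player $\alpha$ to win node $v$ is a set consisting of exactly one outgoing edge of $v$ if $O(v)=\alpha$, and of all outgoing edges of $v$ if $O(v)=\bar\alpha$. Given $H:V\to\{0,1\}$, a direct justification $dj$ wins $v$ for $\alpha$ under $H$ if $H(w)=\alpha$ for all $(v,w)\in dj$. A justification is a tuple $J=(V,D,H)$ with $D\subseteq E$ and $H:V\to\{0,1\}$. A node is justified if it has outgoing edges in $D$. $J$ is weakly winning if for every justified node $u$, the set of its outgoing edges in $D$ is a direct justification that wins $u$ for $H(u)$ under $H$. For a node $v$, a player $\alpha$ and $dj$ either empty or a direct justification of $v$, $J[v:dj,\alpha]$ denotes the justification $(V,D',H')$ where $D'$ is obtained from $D$ by replacing all outgoing edges of $v$ by the edges of $dj$, and $H'$ equals $H$ except $H'(v)=\alpha$. For a set $S$, $J[u:\emptyset,H_f(u)\mid u\in S]$ applies this simultaneously to all $u\in S$ (removing all outgoing edges of each $u\in S$ and setting $H'(u)=H_f(u)$). A cycle in a justification $(V,D,H)$ is a finite sequence of nodes following edges of $D$ that ends in its starting node. -}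

module Defs where

open import Data.Nat using (ℕ)
open import Data.Fin using (Fin; _≟_)
open import Data.Bool using (Bool; true; false; not; if_then_else_)
open import Data.Product using (Σ; ∃; ∃-syntax; _×_; _,_)
open import Data.List using (List; []; _∷_)
open import Data.List.Membership.Propositional using (_∈_)
open import Relation.Binary.PropositionalEquality using (_≡_)
open import Relation.Nullary using (¬_; does)
open import Function.Bundles using (_⇔_)

-- Players are booleans: false = player 0, true = player 1; ᾱ = not α.
Player : Set
Player = Bool

record ParityGame (n : ℕ) : Set where
  field
    E     : Fin n → Fin n → Bool
    total : ∀ v → ∃[ w ] (E v w ≡ true)
    O     : Fin n → Player
    Pr    : Fin n → ℕ
open ParityGame public

EdgeSet : ℕ → Set
EdgeSet n = Fin n → Fin n → Bool

-- A set of outgoing edges of a fixed node v, given by its set of targets: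
-- dj w ≡ true means (v , w) ∈ dj.
OutEdges : ℕ → Set
OutEdges n = Fin n → Bool

IsDirectJustification : ∀ {n} → ParityGame n → Player → Fin n → OutEdges n → Set
IsDirectJustification G α v dj =
  (O G v ≡ α → ∃[ w ] (E G v w ≡ true × (∀ u → (dj u ≡ true) ⇔ (u ≡ w))))
  × (O G v ≡ not α → ∀ u → dj u ≡ E G v u)

WinsUnder : ∀ {n} → (Fin n → Player) → Player → OutEdges n → Set
WinsUnder H α dj = ∀ w → dj w ≡ true → H w ≡ α

IsJustification : ∀ {n} → ParityGame n → EdgeSet n → Set
IsJustification G D = ∀ u w → D u w ≡ true → E G u w ≡ true

Justified : ∀ {n} → EdgeSet n → Fin n → Set
Justified D u = ∃[ w ] (D u w ≡ true)

WeaklyWinning : ∀ {n} → ParityGame n → EdgeSet n → (Fin n → Player) → Set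
WeaklyWinning G D H =
  IsJustification G D
  × (∀ u → Justified D u →
       IsDirectJustification G (H u) u (D u) × WinsUnder H (H u) (D u))

updD : ∀ {n} → EdgeSet n → Fin n → OutEdges n → EdgeSet n
updD D v dj u w = if does (u ≟ v) then dj w else D u w

updH : ∀ {n} → (Fin n → Player) → Fin n → Player → (Fin n → Player)
updH H v α u = if does (u ≟ v) then α else H u

clearD : ∀ {n} → EdgeSet n → (Fin n → Bool) → EdgeSet n
clearD D S u w = if S u then false else D u w

clearH : ∀ {n} → (Fin n → Player) → (Fin n → Bool) → (Fin n → Player) → (Fin n → Player)
clearH H S Hf u = if S u then Hf u else H u

Walk : ∀ {n} → EdgeSet n → Fin n → List (Fin n) → Fin n → Set
Walk D a []       b = a ≡ b
Walk D a (y ∷ ys) b = (D a y ≡ true) × Walk D y ys b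

IsCycle : ∀ {n} → EdgeSet n → Fin n → List (Fin n) → Set
IsCycle D x xs = ¬ (xs ≡ []) × Walk D x xs x

edgesOf : ∀ {n} → Fin n → List (Fin n) → List (Fin n × Fin n)
edgesOf x []       = []
edgesOf x (y ∷ ys) = (x , y) ∷ edgesOf y ys

ContainsEdgeOf : ∀ {n} → Fin n → OutEdges n → Fin n → List (Fin n) → Set
ContainsEdgeOf v dj x xs = ∃[ w ] (dj w ≡ true × (v , w) ∈ edgesOf x xs)

PassesThrough : ∀ {n} → Fin n → Fin n → List (Fin n) → Set
PassesThrough v x xs = v ∈ (x ∷ xs)

Reaches : ∀ {n} → EdgeSet n → Fin n → Fin n → Set
Reaches D a b = ∃[ xs ] Walk D a xs b

-- Weak winningness is a local condition: every justified node must carry a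
-- direct justification that wins it under H.  Changing D and H at some nodes
-- therefore only has to be checked at the changed nodes and at their
-- D-predecessors, whose winning edges may now point to a node of different
-- colour.  In (i) v has no predecessors, in (ii) S is closed under
-- predecessors, and in (iii) the colour of v does not change.
-- For the cycles: a new cycle must use a new edge (v , w) of dj, and rotating
-- it gives a walk from w back to v that follows old D-edges until it first
-- reaches v.  In (i) no edge of J' enters v, so no such walk exists.
module Submission where

open import Defs
open import Data.Nat using (ℕ)
open import Data.Fin using (Fin; _≟_)
open import Data.Bool using (Bool; true; false; not)
import Data.Bool as Bool
open import Data.Bool.Properties using (not-¬; ¬-not)
open import Data.Product using (∃-syntax; _×_; _,_; proj₁; proj₂)
open import Data.Sum using (_⊎_; inj₁; inj₂)
open import Data.List using ([]; _∷_; _++_)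
open import Data.List.Membership.Propositional using (_∈_)
open import Data.List.Relation.Unary.Any using (here; there)
open import Function using (_∘_)
open import Function.Bundles using (Equivalence; mk⇔)
open import Relation.Binary.PropositionalEquality
  using (_≡_; _≢_; refl; sym; trans; subst)
open import Relation.Nullary using (¬_; Dec; yes; no; contradiction)

module _ {n : ℕ} where

  walk-++ : ∀ {D : EdgeSet n} {a b c} {xs ys} →
            Walk D a xs b → Walk D b ys c → Walk D a (xs ++ ys) c
  walk-++ {xs = []}     refl      q = q
  walk-++ {xs = _ ∷ _}  (e , p)   q = e , walk-++ p q

  walk-mono : ∀ {D₁ D₂ : EdgeSet n} → (∀ u w → D₁ u w ≡ true → D₂ u w ≡ true) →
              ∀ {a b} xs → Walk D₁ a xs b → Walk D₂ a xs b
  walk-mono D₁⊆D₂ []       refl    = refl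
  walk-mono D₁⊆D₂ (y ∷ ys) (e , p) = D₁⊆D₂ _ y e , walk-mono D₁⊆D₂ ys p

  walk-last-edge : ∀ {D : EdgeSet n} {a y b} ys →
                   Walk D a (y ∷ ys) b → ∃[ u ] (D u b ≡ true)
  walk-last-edge {a = a} []       (e , refl) = a , e
  walk-last-edge         (z ∷ zs) (_ , p)    = walk-last-edge zs p

  ∈-edgesOf⇒∈ : ∀ {v w x : Fin n} xs → (v , w) ∈ edgesOf x xs → v ∈ (x ∷ xs)
  ∈-edgesOf⇒∈ (_ ∷ _)  (here refl) = here refl
  ∈-edgesOf⇒∈ (_ ∷ ys) (there m)   = there (∈-edgesOf⇒∈ ys m)

  walk-split : ∀ {D : EdgeSet n} {v w a b} xs → (v , w) ∈ edgesOf a xs → Walk D a xs b →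
               ∃[ ps ] ∃[ qs ] (Walk D a ps v × D v w ≡ true × Walk D w qs b)
  walk-split (y ∷ ys) (here refl) (e , p) = [] , ys , refl , e , p
  walk-split (y ∷ ys) (there m)   (e , p) with walk-split ys m p
  ... | ps , qs , p₁ , e′ , p₂ = y ∷ ps , qs , (e , p₁) , e′ , p₂

  cycle-edge⇒return : ∀ {D : EdgeSet n} {v w x} xs → (v , w) ∈ edgesOf x xs →
                      Walk D x xs x → D v w ≡ true × Reaches D w v
  cycle-edge⇒return xs m p with walk-split xs m p
  ... | ps , qs , p₁ , e , p₂ = e , qs ++ ps , walk-++ p₂ p₁

  WinningAt : ParityGame n → EdgeSet n → (Fin n → Player) → Fin n → Set
  WinningAt G D H u = IsDirectJustification G (H u) u (D u) × WinsUnder H (H u) (D u)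

  module _ {G : ParityGame n} where

    directJustification-edges : ∀ {α v dj} → IsDirectJustification G α v dj →
                                ∀ w → dj w ≡ true → E G v w ≡ true
    directJustification-edges {α} {v} (owned , opposed) w djw with O G v Bool.≟ α
    ... | yes Ov≡α = let w₀ , e , dj≡w₀ = owned Ov≡α
                     in subst (λ z → E G v z ≡ true) (sym (Equivalence.to (dj≡w₀ w) djw)) e
    ... | no  Ov≢α = trans (sym (opposed (¬-not Ov≢α) w)) djw

    directJustification-resp : ∀ {α v} {dj dj′ : OutEdges n} → (∀ w → dj w ≡ dj′ w) →
                               IsDirectJustification G α v dj → IsDirectJustification G α v dj′
    directJustification-resp dj≗dj′ (owned , opposed) =
      (λ Ov≡α → let w₀ , e , dj≡w₀ = owned Ov≡α in
         w₀ , e , λ u → mk⇔ (Equivalence.to (dj≡w₀ u) ∘ trans (dj≗dj′ u))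
                            (trans (sym (dj≗dj′ u)) ∘ Equivalence.from (dj≡w₀ u)))
      , λ Ov≡ᾱ u → trans (sym (dj≗dj′ u)) (opposed Ov≡ᾱ u)

    winningAt-intro : ∀ {D : EdgeSet n} {H K : Fin n → Player} {u β dj} →
                      IsDirectJustification G β u dj → WinsUnder K β dj →
                      (∀ w → D u w ≡ dj w) → H u ≡ β → (∀ w → dj w ≡ true → H w ≡ K w) →
                      WinningAt G D H u
    winningAt-intro {D} {u = u} isDJ wins Du≗dj Hu≡β H≗K =
      subst (λ γ → IsDirectJustification G γ u (D u)) (sym Hu≡β)
            (directJustification-resp (sym ∘ Du≗dj) isDJ)
      , λ w Duw → let djw = trans (sym (Du≗dj w)) Duw
                  in trans (H≗K w djw) (trans (wins w djw) (sym Hu≡β))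

    weaklyWinning-intro : ∀ {D : EdgeSet n} {H} →
                          (∀ u → Justified D u → WinningAt G D H u) → WeaklyWinning G D H
    weaklyWinning-intro winning =
      (λ u w Duw → directJustification-edges (proj₁ (winning u (w , Duw))) w Duw) , winning

  module _ (H : Fin n → Player) (v : Fin n) (α : Player) where

    updH-self : updH H v α v ≡ α
    updH-self with v ≟ v
    ... | yes _   = refl
    ... | no  v≢v = contradiction refl v≢v

    updH-other : ∀ {u} → u ≢ v → updH H v α u ≡ H u
    updH-other {u} u≢v with u ≟ v
    ... | yes u≡v = contradiction u≡v u≢v
    ... | no  _   = refl

    updH-unchanged : ∀ w → (w ≡ v → H v ≡ α) → updH H v α w ≡ H w
    updH-unchanged w Hv≡α with w ≟ v
    ... | yes refl = sym (Hv≡α refl)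
    ... | no  _    = refl

  module _ (D : EdgeSet n) (v : Fin n) (dj : OutEdges n) where

    updD-self : ∀ w → updD D v dj v w ≡ dj w
    updD-self w with v ≟ v
    ... | yes _   = refl
    ... | no  v≢v = contradiction refl v≢v

    updD-other : ∀ {u} w → u ≢ v → updD D v dj u w ≡ D u w
    updD-other {u} w u≢v with u ≟ v
    ... | yes u≡v = contradiction u≡v u≢v
    ... | no  _   = refl

    updD-walk : ∀ {a b} xs → Walk (updD D v dj) a xs b →
                Walk D a xs b ⊎ ∃[ w ] (dj w ≡ true × (v , w) ∈ edgesOf a xs)
    updD-walk         []       refl    = inj₁ refl
    updD-walk {a = a} (y ∷ ys) (e , p) with a ≟ v
    ... | yes refl = inj₂ (y , e , here refl)
    ... | no  _    with updD-walk ys p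
    ...   | inj₁ q              = inj₁ (e , q)
    ...   | inj₂ (w , djw , m)  = inj₂ (w , djw , there m)

    updD-reaches : ∀ {a} xs → Walk (updD D v dj) a xs v → Reaches D a v
    updD-reaches         []       refl    = [] , refl
    updD-reaches {a = a} (y ∷ ys) (e , p) with a ≟ v
    ... | yes refl = [] , refl
    ... | no  _    = let zs , q = updD-reaches ys p
                     in y ∷ zs , e , q

    updD-cycle-new : ∀ {x} xs → IsCycle (updD D v dj) x xs → ¬ IsCycle D x xs →
                     ContainsEdgeOf v dj x xs
    updD-cycle-new xs (xs≢[] , p) notOld with updD-walk xs p
    ... | inj₁ q   = contradiction (xs≢[] , q) notOld
    ... | inj₂ new = new

    updD-cycle-old : (∀ w → dj w ≡ true → ¬ Reaches D w v) →
                     ∀ {x} xs → IsCycle (updD D v dj) x xs → IsCycle D x xs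
    updD-cycle-old unreachable xs (xs≢[] , p) with updD-walk xs p
    ... | inj₁ q             = xs≢[] , q
    ... | inj₂ (w , djw , m) = let _ , zs , q = cycle-edge⇒return xs m p
                               in contradiction (updD-reaches zs q) (unreachable w djw)

    updD-cycle-avoids-dj : (∀ u → D u v ≡ false) → dj v ≡ false →
                           ∀ {x} xs → IsCycle (updD D v dj) x xs → ¬ ContainsEdgeOf v dj x xs
    updD-cycle-avoids-dj noPreds djv≡false xs (_ , p) (w , _ , m) =
      let e , zs , q = cycle-edge⇒return xs m p
          u , D′uv = walk-last-edge zs (e , q)
      in contradiction (trans (sym D′uv) (noEdgeInto u)) λ ()
      where
      noEdgeInto : ∀ u → updD D v dj u v ≡ false
      noEdgeInto u with u ≟ v
      ... | yes refl = djv≡false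
      ... | no  _    = noPreds u

    updD-weaklyWinning : ∀ {G H α} → WeaklyWinning G D H → IsDirectJustification G α v dj →
                         WinsUnder H α dj → (∀ u → D u v ≡ true → H v ≡ α) →
                         WeaklyWinning G (updD D v dj) (updH H v α)
    updD-weaklyWinning {G} {H} {α} (_ , winning) isDJ wins preds≡α =
      weaklyWinning-intro {G = G} {D = updD D v dj} {H = updH H v α} winningAt
      where
      winningAt : ∀ u → Justified (updD D v dj) u → WinningAt G (updD D v dj) (updH H v α) u
      winningAt u (w , e) = byNode (u ≟ v)
        where
        byNode : Dec (u ≡ v) → WinningAt G (updD D v dj) (updH H v α) u
        byNode (yes refl) =
          winningAt-intro {G = G} {D = updD D v dj} isDJ wins updD-self (updH-self H v α)
            (λ w djw → updH-unchanged H v α w λ { refl → wins v djw })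
        byNode (no u≢v) =
          let isDJᵤ , winsᵤ = winning u (w , trans (sym (updD-other w u≢v)) e)
          in winningAt-intro {G = G} {D = updD D v dj} isDJᵤ winsᵤ
               (λ w → updD-other w u≢v) (updH-other H v α u≢v)
               (λ w Duw → updH-unchanged H v α w λ { refl → preds≡α u Duw })

  module _ (D : EdgeSet n) (S : Fin n → Bool) where

    clearD-outside : ∀ {u} w → S u ≡ false → clearD D S u w ≡ D u w
    clearD-outside {u} w Su≡false with S u
    ... | false = refl

    clearH-outside : ∀ {H Hf u} → S u ≡ false → clearH H S Hf u ≡ H u
    clearH-outside {u = u} Su≡false with S u
    ... | false = refl

    clearD-⊆ : ∀ u w → clearD D S u w ≡ true → S u ≡ false × D u w ≡ true
    clearD-⊆ u w e with S u
    ... | false = refl , e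

    clearD-cycle : ∀ {x} xs → IsCycle (clearD D S) x xs → IsCycle D x xs
    clearD-cycle xs (xs≢[] , p) = xs≢[] , walk-mono (λ u w → proj₂ ∘ clearD-⊆ u w) xs p

    clearD-weaklyWinning : ∀ {G H Hf} → WeaklyWinning G D H →
                           (∀ u w → S u ≡ true → D w u ≡ true → S w ≡ true) →
                           WeaklyWinning G (clearD D S) (clearH H S Hf)
    clearD-weaklyWinning {G} {H} {Hf} (_ , winning) closed =
      weaklyWinning-intro {G = G} {D = clearD D S} {H = clearH H S Hf} winningAt
      where
      successor-outside : ∀ {u w} → S u ≡ false → D u w ≡ true → S w ≡ false
      successor-outside {u} {w} Su≡false Duw with S w Bool.≟ true
      ... | yes Sw≡true = contradiction (trans (sym Su≡false) (closed w u Sw≡true Duw)) λ ()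
      ... | no  Sw≢true = ¬-not Sw≢true

      winningAt : ∀ u → Justified (clearD D S) u → WinningAt G (clearD D S) (clearH H S Hf) u
      winningAt u (w , e) =
        let Su≡false , Duw = clearD-⊆ u w e
            isDJᵤ , winsᵤ = winning u (w , Duw)
        in winningAt-intro {G = G} {D = clearD D S} isDJᵤ winsᵤ
             (λ w → clearD-outside w Su≡false) (clearH-outside {H} {Hf} Su≡false)
             (λ w Duw → clearH-outside {H} {Hf} (successor-outside Su≡false Duw))

proposition2 : ∀ {n} (G : ParityGame n) (D : EdgeSet n) (H : Fin n → Player)
    → WeaklyWinning G D H
    → (∀ (v : Fin n) (α : Player) (dj : OutEdges n)
         → IsDirectJustification G α v dj
         → H v ≡ not α
         → (∀ w → D w v ≡ false)
         → WinsUnder H α dj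
         → WeaklyWinning G (updD D v dj) (updH H v α)
           × (∀ x xs → IsCycle (updD D v dj) x xs → ¬ ContainsEdgeOf v dj x xs))
    × (∀ (S : Fin n → Bool) (Hf : Fin n → Player)
         → (∀ u w → S u ≡ true → D w u ≡ true → S w ≡ true)
         → WeaklyWinning G (clearD D S) (clearH H S Hf)
           × (∀ x xs → IsCycle (clearD D S) x xs → IsCycle D x xs))
    × (∀ (v : Fin n) (α : Player) (dj : OutEdges n)
         → IsDirectJustification G α v dj
         → H v ≡ α
         → WinsUnder H α dj
         → WeaklyWinning G (updD D v dj) (updH H v α)
           × ((dj v ≡ false × (∀ w → dj w ≡ true → ¬ Reaches D w v)
                → ∀ x xs → IsCycle (updD D v dj) x xs → IsCycle D x xs)
             × (¬ (dj v ≡ false × (∀ w → dj w ≡ true → ¬ Reaches D w v))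
                → ∀ x xs → IsCycle (updD D v dj) x xs → ¬ IsCycle D x xs
                  → PassesThrough v x xs × ContainsEdgeOf v dj x xs)))
proposition2 G D H ww =
  (λ v α dj isDJ Hv≡ᾱ noPreds wins →
     let djv≡false = ¬-not λ djv → not-¬ (wins v djv) Hv≡ᾱ
     in updD-weaklyWinning D v dj {G} ww isDJ wins
          (λ u Duv → contradiction (trans (sym Duv) (noPreds u)) λ ())
        , λ x xs → updD-cycle-avoids-dj D v dj noPreds djv≡false xs)
  , (λ S Hf closed →
       clearD-weaklyWinning D S {G} ww closed , λ x xs → clearD-cycle D S xs)
  , (λ v α dj isDJ Hv≡α wins →
       updD-weaklyWinning D v dj {G} ww isDJ wins (λ _ _ → Hv≡α)
       , (λ (_ , unreachable) x xs → updD-cycle-old D v dj unreachable xs)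
       , λ _ x xs cyc notOld →
           let new@(_ , _ , m) = updD-cycle-new D v dj xs cyc notOld
           in ∈-edgesOf⇒∈ xs m , new)
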